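{- Let $(A,B)$ be an invertible Jones pair of $n\times n$ complex matrices with $A$ symmetric, let $d^2=n$, and let \[ V=\begin{pmatrix} dA & -dA & B^{(-)} & B^{(-)}\\ -dA & dA & B^{(-)} & B^{(-)}\\ (B^{(-)})^T & (B^{(-)})^T & dA & -dA\\ (B^{(-)})^T & (B^{(-)})^T & -dA & dA \end{pmatrix}. \] Then $V\in\mathcal B=\{\mathcal M(F,G,H) : F\in\mathcal N_A,\ G,H\in\mathcal N_{A,B}\}$.
   Context: All matrices are complex. For $n\times n$ matrices $X,Y$, $X\circ Y$ is the Schur product; if $X$ has no zero entry, $X^{(-)}$ is its Schur inverse, $(X^{(-)})_{ij}=1/X_{ij}$. $e_1,\dots,e_n$ is the standard basis of $\mathbb C^n$. $W$ ($n\times n$) is type-II if $W(W^{(-)})^T=nI$. For a matrix $C$, $X_C(M)=CM$, $\Delta_C(M)=C\circ M$. A Jones pair is a pair $(A,B)$ of $n\times n$ matrices with $X_A$, $\Delta_B$ invertible, $X_A\Delta_BX_A=\Delta_BX_A\Delta_B$ and $X_A\Delta_{B^T}X_A=\Delta_{B^T}X_A\Delta_{B^T}$; it is invertible if moreover $A$ has no zero entry and $B$ is invertible (equivalently $A,B$ type-II). For $P$ invertible and $Q$ without zero entries, $\mathcal N_{P,Q}$ is the set of matrices $M$ such that each $Pe_i\circ Qe_j$ is an eigenvector of $M$; for such $M$, $\Theta_{P,Q}(M)$ is the matrix with $M(Pe_i\circ Qe_j)=\Theta_{P,Q}(M)_{ij}(Pe_i\circ Qe_j)$. For type-II $P$,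 $\mathcal N_P:=\mathcal N_{P,P^{(-)}}$, $\Theta_P:=\Theta_{P,P^{(-)}}$. Standing facts (for an invertible Jones pair with $A$ symmetric) needed for the definitions: $\mathcal N_{A,B}=\mathcal N_{A,B^T}$ is closed under transposition and $\mathcal N_A=\mathcal N_{B^{(-)}}$. Pairing: for $H\in\mathcal N_{A,B}$, the matrix paired with $H$ is the unique $K$ with $K^T\in\mathcal N_{A,B^T}$ and $\Theta_{A,B}(H)=\Theta_{A,B^T}(K^T)^T$. For $F\in\mathcal N_A$, $G,H\in\mathcal N_{A,B}$, with $K$ paired with $H$, \[ \mathcal M(F,G,H)=\begin{pmatrix} \Theta_A(F)+H & \Theta_A(F)-H & \Theta_{A,B}(G) & \Theta_{A,B}(G)\\ \Theta_A(F)-H & \Theta_A(F)+H & \Theta_{A,B}(G) & \Theta_{A,B}(G)\\ \Theta_{A,B}(G^T)^T & \Theta_{A,B}(G^T)^T & \Theta_{B^{(-)}}(F)+K & \Theta_{B^{(-)}}(F)-K\\ \Theta_{A,B}(G^T)^T & \Theta_{A,B}(G^T)^T & \Theta_{B^{(-)}}(F)-K & \Theta_{B^{(-)}}(F)+K \end{pmatrix}. \] -}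

module Defs where

open import Level using (Level; _⊔_) renaming (suc to lsuc)
open import Data.Nat using (ℕ; zero; suc)
open import Data.Fin using (Fin; zero; suc)
open import Data.List using (List; []; _∷_; length)
open import Data.Product using (Σ; ∃; _×_; _,_)
open import Relation.Nullary using (¬_)
open import Relation.Binary.PropositionalEquality using (_≡_)
open import Algebra.Bundles using (CommutativeRing)

natR : ∀ {c ℓ} (R : CommutativeRing c ℓ) → ℕ → CommutativeRing.Carrier R
natR R zero = CommutativeRing.0# R
natR R (suc m) = CommutativeRing._+_ R (CommutativeRing.1# R) (natR R m)

-- Evaluation of the monic polynomial x^(length cs) + Σ_k cs[k] x^k  (Horner form):
-- monicEval [c0, c1, ..., c(m-1)] x = c0 + x (c1 + x ( ... (c(m-1) + x) ...)).
monicEval : ∀ {c ℓ} (R : CommutativeRing c ℓ) → List (CommutativeRing.Carrier R) →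
            CommutativeRing.Carrier R → CommutativeRing.Carrier R
monicEval R [] x = CommutativeRing.1# R
monicEval R (a ∷ cs) x = CommutativeRing._+_ R a (CommutativeRing._*_ R x (monicEval R cs x))

-- An algebraically closed field of characteristic 0 (stand-in for ℂ).
-- The inverse is a total function, required to be a genuine inverse on nonzero elements.
record ACF0 (c ℓ : Level) : Set (lsuc (c ⊔ ℓ)) where
  field
    cring : CommutativeRing c ℓ
  open CommutativeRing cring public
  field
    _⁻¹ : Carrier → Carrier
    ⁻¹-inverse : ∀ x → ¬ (x ≈ 0#) → (x * (x ⁻¹)) ≈ 1#
    0≉1 : ¬ (0# ≈ 1#)
    char0 : ∀ m → ¬ (natR cring (suc m) ≈ 0#)
    algClosed : (cs : List Carrier) → ¬ (length cs ≡ 0) → ∃ λ x → monicEval cring cs x ≈ 0#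

module Matrices {c ℓ : Level} (𝔽 : ACF0 c ℓ) where
  open ACF0 𝔽 public using (cring; Carrier; _≈_; _+_; _*_; _-_; -_; 0#; 1#; _⁻¹)

  infix 4 _≋_ _≋B_
  infixl 7 _·_ _∘ₛ_ _⊛_
  infixl 6 _⊕_ _⊖_
  infix 9 _ᵀ _⁽⁻⁾

  K : Set c
  K = Carrier

  Matrix : ℕ → Set c
  Matrix n = Fin n → Fin n → K

  _≋_ : ∀ {n} → Matrix n → Matrix n → Set ℓ
  M ≋ N = ∀ i j → M i j ≈ N i j

  sumFin : ∀ {n} → (Fin n → K) → K
  sumFin {zero} f = 0#
  sumFin {suc n} f = f zero + sumFin (λ i → f (suc i))

  _·_ : ∀ {n} → Matrix n → Matrix n → Matrix n
  (M · N) i j = sumFin (λ k → M i k * N k j)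

  _∘ₛ_ : ∀ {n} → Matrix n → Matrix n → Matrix n
  (M ∘ₛ N) i j = M i j * N i j

  _⊕_ : ∀ {n} → Matrix n → Matrix n → Matrix n
  (M ⊕ N) i j = M i j + N i j

  _⊖_ : ∀ {n} → Matrix n → Matrix n → Matrix n
  (M ⊖ N) i j = M i j - N i j

  _⊛_ : ∀ {n} → K → Matrix n → Matrix n
  (a ⊛ M) i j = a * M i j

  ⊝_ : ∀ {n} → Matrix n → Matrix n
  (⊝ M) i j = - (M i j)

  _ᵀ : ∀ {n} → Matrix n → Matrix n
  (M ᵀ) i j = M j i

  _⁽⁻⁾ : ∀ {n} → Matrix n → Matrix n
  (M ⁽⁻⁾) i j = (M i j) ⁻¹

  δ : ∀ {n} → Fin n → Fin n → K
  δ zero zero = 1#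
  δ zero (suc j) = 0#
  δ (suc i) zero = 0#
  δ (suc i) (suc j) = δ i j

  I : ∀ {n} → Matrix n
  I = δ

  NoZeroEntry : ∀ {n} → Matrix n → Set ℓ
  NoZeroEntry M = ∀ i j → ¬ (M i j ≈ 0#)

  Symmetric : ∀ {n} → Matrix n → Set ℓ
  Symmetric M = M ᵀ ≋ M

  InvertibleMatrix : ∀ {n} → Matrix n → Set (c ⊔ ℓ)
  InvertibleMatrix {n} M = Σ (Matrix n) λ N → (M · N ≋ I) × (N · M ≋ I)

  X : ∀ {n} → Matrix n → Matrix n → Matrix n
  X C M = C · M

  Δ : ∀ {n} → Matrix n → Matrix n → Matrix n
  Δ C M = C ∘ₛ M

  InvertibleOp : ∀ {n} → (Matrix n → Matrix n) → Set (c ⊔ ℓ)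
  InvertibleOp {n} f = Σ (Matrix n → Matrix n) λ g →
    (∀ M → f (g M) ≋ M) × (∀ M → g (f M) ≋ M)

  JonesPair : ∀ {n} → Matrix n → Matrix n → Set (c ⊔ ℓ)
  JonesPair A B =
    InvertibleOp (X A) × InvertibleOp (Δ B) ×
    (∀ M → X A (Δ B (X A M)) ≋ Δ B (X A (Δ B M))) ×
    (∀ M → X A (Δ (B ᵀ) (X A M)) ≋ Δ (B ᵀ) (X A (Δ (B ᵀ) M)))

  InvertibleJonesPair : ∀ {n} → Matrix n → Matrix n → Set (c ⊔ ℓ)
  InvertibleJonesPair A B = JonesPair A B × NoZeroEntry A × InvertibleMatrix B

  -- IsΘ P Q M T : for all i j, the vector P e_i ∘ Q e_j (k-th entry P k i * Q k j)
  -- is an eigenvector of M with eigenvalue T i j.  So M ∈ N_{P,Q} iff ∃ T. IsΘ P Q M T,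
  -- and then T = Θ_{P,Q}(M) (unique, as these vectors are nonzero).
  IsΘ : ∀ {n} → Matrix n → Matrix n → Matrix n → Matrix n → Set ℓ
  IsΘ P Q M T = ∀ i j k →
    sumFin (λ l → M k l * (P l i * Q l j)) ≈ T i j * (P k i * Q k j)

  BlockMatrix : ℕ → Set c
  BlockMatrix n = Fin 4 → Fin 4 → Matrix n

  _≋B_ : ∀ {n} → BlockMatrix n → BlockMatrix n → Set ℓ
  U ≋B W = ∀ a b → U a b ≋ W a b

  Vmat : ∀ {n} → K → Matrix n → Matrix n → BlockMatrix n
  Vmat d A B zero zero = d ⊛ A
  Vmat d A B zero (suc zero) = ⊝ (d ⊛ A)
  Vmat d A B zero (suc (suc zero)) = B ⁽⁻⁾
  Vmat d A B zero (suc (suc (suc zero))) = B ⁽⁻⁾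
  Vmat d A B (suc zero) zero = ⊝ (d ⊛ A)
  Vmat d A B (suc zero) (suc zero) = d ⊛ A
  Vmat d A B (suc zero) (suc (suc zero)) = B ⁽⁻⁾
  Vmat d A B (suc zero) (suc (suc (suc zero))) = B ⁽⁻⁾
  Vmat d A B (suc (suc zero)) zero = (B ⁽⁻⁾) ᵀ
  Vmat d A B (suc (suc zero)) (suc zero) = (B ⁽⁻⁾) ᵀ
  Vmat d A B (suc (suc zero)) (suc (suc zero)) = d ⊛ A
  Vmat d A B (suc (suc zero)) (suc (suc (suc zero))) = ⊝ (d ⊛ A)
  Vmat d A B (suc (suc (suc zero))) zero = (B ⁽⁻⁾) ᵀ
  Vmat d A B (suc (suc (suc zero))) (suc zero) = (B ⁽⁻⁾) ᵀ
  Vmat d A B (suc (suc (suc zero))) (suc (suc zero)) = ⊝ (d ⊛ A)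
  Vmat d A B (suc (suc (suc zero))) (suc (suc (suc zero))) = d ⊛ A

  -- 𝓜(F,G,H) given its ingredients:
  --   ΘAF = Θ_A(F), ΘB⁻F = Θ_{B^(-)}(F), ΘG = Θ_{A,B}(G), ΘGt = Θ_{A,B}(G^T), H, Kp = K.
  𝓜blocks : ∀ {n} → (ΘAF ΘB⁻F ΘG ΘGt H Kp : Matrix n) → BlockMatrix n
  𝓜blocks ΘAF ΘB⁻F ΘG ΘGt H Kp zero zero = ΘAF ⊕ H
  𝓜blocks ΘAF ΘB⁻F ΘG ΘGt H Kp zero (suc zero) = ΘAF ⊖ H
  𝓜blocks ΘAF ΘB⁻F ΘG ΘGt H Kp zero (suc (suc zero)) = ΘG
  𝓜blocks ΘAF ΘB⁻F ΘG ΘGt H Kp zero (suc (suc (suc zero))) = ΘG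
  𝓜blocks ΘAF ΘB⁻F ΘG ΘGt H Kp (suc zero) zero = ΘAF ⊖ H
  𝓜blocks ΘAF ΘB⁻F ΘG ΘGt H Kp (suc zero) (suc zero) = ΘAF ⊕ H
  𝓜blocks ΘAF ΘB⁻F ΘG ΘGt H Kp (suc zero) (suc (suc zero)) = ΘG
  𝓜blocks ΘAF ΘB⁻F ΘG ΘGt H Kp (suc zero) (suc (suc (suc zero))) = ΘG
  𝓜blocks ΘAF ΘB⁻F ΘG ΘGt H Kp (suc (suc zero)) zero = ΘGt ᵀ
  𝓜blocks ΘAF ΘB⁻F ΘG ΘGt H Kp (suc (suc zero)) (suc zero) = ΘGt ᵀ
  𝓜blocks ΘAF ΘB⁻F ΘG ΘGt H Kp (suc (suc zero)) (suc (suc zero)) = ΘB⁻F ⊕ Kp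
  𝓜blocks ΘAF ΘB⁻F ΘG ΘGt H Kp (suc (suc zero)) (suc (suc (suc zero))) = ΘB⁻F ⊖ Kp
  𝓜blocks ΘAF ΘB⁻F ΘG ΘGt H Kp (suc (suc (suc zero))) zero = ΘGt ᵀ
  𝓜blocks ΘAF ΘB⁻F ΘG ΘGt H Kp (suc (suc (suc zero))) (suc zero) = ΘGt ᵀ
  𝓜blocks ΘAF ΘB⁻F ΘG ΘGt H Kp (suc (suc (suc zero))) (suc (suc zero)) = ΘB⁻F ⊖ Kp
  𝓜blocks ΘAF ΘB⁻F ΘG ΘGt H Kp (suc (suc (suc zero))) (suc (suc (suc zero))) = ΘB⁻F ⊕ Kp

  -- U ∈ 𝓑 = { 𝓜(F,G,H) : F ∈ N_A, G,H ∈ N_{A,B} }: witnesses F, G, H, the matrix Kp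
  -- paired with H, and the Θ-values needed to build 𝓜(F,G,H).
  record In𝓑 {n} (A B : Matrix n) (U : BlockMatrix n) : Set (c ⊔ ℓ) where
    field
      F G H Kp : Matrix n
      ΘAF ΘB⁻F ΘG ΘGt ΘH ΘKt : Matrix n
      -- F ∈ N_A = N_{A,A^(-)} with Θ_A(F) = ΘAF
      isΘAF : IsΘ A (A ⁽⁻⁾) F ΘAF
      -- F ∈ N_{B^(-)} = N_{B^(-),(B^(-))^(-)} with Θ_{B^(-)}(F) = ΘB⁻F
      isΘB⁻F : IsΘ (B ⁽⁻⁾) ((B ⁽⁻⁾) ⁽⁻⁾) F ΘB⁻F
      isΘG : IsΘ A B G ΘG
      isΘGt : IsΘ A B (G ᵀ) ΘGt
      isΘH : IsΘ A B H ΘH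
      -- Kp paired with H: Kp^T ∈ N_{A,B^T} and Θ_{A,B}(H) = Θ_{A,B^T}(Kp^T)^T
      isΘKt : IsΘ A (B ᵀ) (Kp ᵀ) ΘKt
      paired : ΘH ≋ (ΘKt ᵀ)
      equal : U ≋B 𝓜blocks ΘAF ΘB⁻F ΘG ΘGt H Kp

{-# OPTIONS --safe #-}
-- Take F = 0, G = A⁻¹ and H = dA.  Applying the braid relation
-- X_A Δ_C X_A = Δ_C X_A Δ_C to the matrix whose columns all equal e_i shows
-- A (A e_i ∘ C e_j) = C_ij (A e_i ∘ C e_j) for C = B and C = Bᵀ; hence
-- Θ_{A,B}(dA) = dB, Θ_{A,B^T}(dA) = dBᵀ, and Θ_{A,B}(A⁻¹) = B^(-) because B
-- has no zero entry.  As A is symmetric, so is A⁻¹, and the matrix paired with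
-- dA is dA itself.
module Submission where

open import Defs
open import Data.Nat using (ℕ; zero; suc)
open import Data.Fin using (Fin; zero; suc)
open import Data.Fin.Patterns using (0F; 1F; 2F; 3F)
open import Data.Vec.Functional using (Vector)
open import Data.Product using (_,_)
open import Relation.Nullary using (¬_)
open import Relation.Binary.PropositionalEquality as ≡ using (_≡_)
import Algebra.Properties.Semiring.Sum as SemiringSum
import Algebra.Properties.CommutativeSemigroup as CommutativeSemigroupProperties
import Relation.Binary.Reasoning.Setoid as SetoidReasoning

module MatrixTheory {c ℓ} (𝔽 : ACF0 c ℓ) where
  open Matrices 𝔽
  open ACF0 𝔽 hiding (zero; cring; Carrier; _≈_; _+_; _*_; _-_; -_; 0#; 1#; _⁻¹)
  open SemiringSum semiring using (sum; sum-cong-≋; sum-cong-≗; ∑-comm; *-distribˡ-sum; *-distribʳ-sum)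
  open CommutativeSemigroupProperties *-commutativeSemigroup using (x∙yz≈y∙xz; x∙yz≈z∙yx)
  open SetoidReasoning setoid

  private variable
    n : ℕ
    t : K
    f g x : Vector K n
    A C L M N P Q R T : Matrix n

  sumFin≡sum : (f : Vector K n) → sumFin f ≡ sum f
  sumFin≡sum {zero} f = ≡.refl
  sumFin≡sum {suc n} f = ≡.cong (f zero +_) (sumFin≡sum (λ i → f (suc i)))

  sumFin-cong : (∀ i → f i ≈ g i) → sumFin f ≈ sumFin g
  sumFin-cong {f = f} {g = g} f≈g = begin
    sumFin f ≡⟨ sumFin≡sum f ⟩
    sum f    ≈⟨ sum-cong-≋ f≈g ⟩
    sum g    ≡⟨ sumFin≡sum g ⟨
    sumFin g ∎

  *-distribˡ-sumFin : ∀ a (f : Vector K n) → a * sumFin f ≈ sumFin (λ i → a * f i)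
  *-distribˡ-sumFin a f = begin
    a * sumFin f             ≡⟨ ≡.cong (a *_) (sumFin≡sum f) ⟩
    a * sum f                ≈⟨ *-distribˡ-sum a f ⟩
    sum (λ i → a * f i)      ≡⟨ sumFin≡sum (λ i → a * f i) ⟨
    sumFin (λ i → a * f i)   ∎

  *-distribʳ-sumFin : ∀ a (f : Vector K n) → sumFin f * a ≈ sumFin (λ i → f i * a)
  *-distribʳ-sumFin a f = begin
    sumFin f * a             ≡⟨ ≡.cong (_* a) (sumFin≡sum f) ⟩
    sum f * a                ≈⟨ *-distribʳ-sum a f ⟩
    sum (λ i → f i * a)      ≡⟨ sumFin≡sum (λ i → f i * a) ⟨
    sumFin (λ i → f i * a)   ∎

  sumFin-comm : ∀ {m n} (h : Fin m → Fin n → K) →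
    sumFin (λ i → sumFin (λ j → h i j)) ≈ sumFin (λ j → sumFin (λ i → h i j))
  sumFin-comm h = begin
    sumFin (λ i → sumFin (λ j → h i j)) ≡⟨ sumFin²≡sum² h ⟩
    sum (λ i → sum (λ j → h i j))       ≈⟨ ∑-comm h ⟩
    sum (λ j → sum (λ i → h i j))       ≡⟨ sumFin²≡sum² (λ j i → h i j) ⟨
    sumFin (λ j → sumFin (λ i → h i j)) ∎
    where
    sumFin²≡sum² : ∀ {m n} (h : Fin m → Fin n → K) →
      sumFin (λ i → sumFin (h i)) ≡ sum (λ i → sum (h i))
    sumFin²≡sum² h = ≡.trans (sumFin≡sum (λ i → sumFin (h i))) (sum-cong-≗ (λ i → sumFin≡sum (h i)))

  sumFin-zeroˡ : (f : Vector K n) → sumFin (λ i → 0# * f i) ≈ 0#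
  sumFin-zeroˡ f = trans (sym (*-distribˡ-sumFin 0# f)) (zeroˡ (sumFin f))

  sumFin-δˡ : (i : Fin n) (f : Vector K n) → sumFin (λ k → δ i k * f k) ≈ f i
  sumFin-δˡ zero f =
    trans (+-cong (*-identityˡ (f zero)) (sumFin-zeroˡ (λ k → f (suc k)))) (+-identityʳ (f zero))
  sumFin-δˡ (suc i) f =
    trans (+-cong (zeroˡ (f zero)) (sumFin-δˡ i (λ k → f (suc k)))) (+-identityˡ (f (suc i)))

  δ-sym : (i j : Fin n) → δ i j ≡ δ j i
  δ-sym zero zero = ≡.refl
  δ-sym zero (suc j) = ≡.refl
  δ-sym (suc i) zero = ≡.refl
  δ-sym (suc i) (suc j) = δ-sym i j

  sumFin-δʳ : (j : Fin n) (f : Vector K n) → sumFin (λ k → f k * δ k j) ≈ f j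
  sumFin-δʳ j f = trans (sumFin-cong (λ k → trans (*-comm (f k) (δ k j)) (reflexive (≡.cong (_* f k) (δ-sym k j)))))
                        (sumFin-δˡ j f)

  infixr 7 _·ᵥ_

  _·ᵥ_ : Matrix n → Vector K n → Vector K n
  (M ·ᵥ x) k = sumFin (λ l → M k l * x l)

  ·-·ᵥ-assoc : (L M : Matrix n) (x : Vector K n) → ∀ k → ((L · M) ·ᵥ x) k ≈ (L ·ᵥ M ·ᵥ x) k
  ·-·ᵥ-assoc L M x k = begin
    sumFin (λ l → sumFin (λ m → L k m * M m l) * x l)
      ≈⟨ sumFin-cong (λ l → trans (*-distribʳ-sumFin (x l) (λ m → L k m * M m l))
                                  (sumFin-cong (λ m → *-assoc (L k m) (M m l) (x l)))) ⟩
    sumFin (λ l → sumFin (λ m → L k m * (M m l * x l)))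
      ≈⟨ sumFin-comm (λ l m → L k m * (M m l * x l)) ⟩
    sumFin (λ m → sumFin (λ l → L k m * (M m l * x l)))
      ≈⟨ sumFin-cong (λ m → sym (*-distribˡ-sumFin (L k m) (λ l → M m l * x l))) ⟩
    sumFin (λ m → L k m * (M ·ᵥ x) m) ∎

  ·-assoc : (L M N : Matrix n) → (L · M) · N ≋ L · (M · N)
  ·-assoc L M N k j = ·-·ᵥ-assoc L M (λ l → N l j) k

  ·-congˡ : M ≋ N → L · M ≋ L · N
  ·-congˡ M≋N i j = sumFin-cong (λ k → *-congˡ (M≋N k j))

  ·-congʳ : M ≋ N → M · L ≋ N · L
  ·-congʳ M≋N i j = sumFin-cong (λ k → *-congʳ (M≋N i k))

  ·-identityˡ : (M : Matrix n) → I · M ≋ M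
  ·-identityˡ M i j = sumFin-δˡ i (λ k → M k j)

  ·-identityʳ : (M : Matrix n) → M · I ≋ M
  ·-identityʳ M i j = sumFin-δʳ j (M i)

  ᵀ-anti-· : (M N : Matrix n) → (M · N) ᵀ ≋ N ᵀ · M ᵀ
  ᵀ-anti-· M N i j = sumFin-cong (λ k → *-comm (M j k) (N k i))

  Iᵀ≋I : I ᵀ ≋ I {n}
  Iᵀ≋I i j = reflexive (δ-sym j i)

  leftInverse≋rightInverse : L · A ≋ I → A · R ≋ I → L ≋ R
  leftInverse≋rightInverse {L = L} {A = A} {R = R} LA≋I AR≋I i j = begin
    L i j             ≈⟨ ·-identityʳ L i j ⟨
    (L · I) i j       ≈⟨ ·-congˡ {L = L} AR≋I i j ⟨
    (L · (A · R)) i j ≈⟨ ·-assoc L A R i j ⟨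
    ((L · A) · R) i j ≈⟨ ·-congʳ {L = R} LA≋I i j ⟩
    (I · R) i j       ≈⟨ ·-identityˡ R i j ⟩
    R i j             ∎

  rightInverse-of-symmetric : Symmetric A → A · R ≋ I → R ᵀ · A ≋ I
  rightInverse-of-symmetric {A = A} {R = R} symA AR≋I i j = begin
    (R ᵀ · A) i j     ≈⟨ ·-congˡ {L = R ᵀ} symA i j ⟨
    (R ᵀ · A ᵀ) i j   ≈⟨ ᵀ-anti-· A R i j ⟨
    (A · R) j i       ≈⟨ AR≋I j i ⟩
    I j i             ≈⟨ Iᵀ≋I i j ⟩
    I i j             ∎

  Eigenpair : Matrix n → K → Vector K n → Set ℓ
  Eigenpair M t x = ∀ k → (M ·ᵥ x) k ≈ t * x k

  eigenpair-leftInverse : L · M ≋ I → ¬ (t ≈ 0#) → Eigenpair M t x → Eigenpair L (t ⁻¹) x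
  eigenpair-leftInverse {L = L} {M = M} {t = t} {x = x} LM≋I t≉0 Mx≈tx k = begin
    (L ·ᵥ x) k               ≈⟨ *-identityˡ ((L ·ᵥ x) k) ⟨
    1# * (L ·ᵥ x) k          ≈⟨ *-congʳ (trans (*-comm (t ⁻¹) t) (⁻¹-inverse t t≉0)) ⟨
    (t ⁻¹ * t) * (L ·ᵥ x) k  ≈⟨ *-assoc (t ⁻¹) t ((L ·ᵥ x) k) ⟩
    t ⁻¹ * (t * (L ·ᵥ x) k)  ≈⟨ *-congˡ x≈t·Lx ⟨
    t ⁻¹ * x k               ∎
    where
    x≈t·Lx : x k ≈ t * (L ·ᵥ x) k
    x≈t·Lx = begin
      x k                               ≈⟨ sumFin-δˡ k x ⟨
      (I ·ᵥ x) k                        ≈⟨ sumFin-cong (λ l → *-congʳ (LM≋I k l)) ⟨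
      ((L · M) ·ᵥ x) k                  ≈⟨ ·-·ᵥ-assoc L M x k ⟩
      (L ·ᵥ M ·ᵥ x) k                   ≈⟨ sumFin-cong (λ m → *-congˡ (Mx≈tx m)) ⟩
      sumFin (λ m → L k m * (t * x m))  ≈⟨ sumFin-cong (λ m → x∙yz≈y∙xz (L k m) t (x m)) ⟩
      sumFin (λ m → t * (L k m * x m))  ≈⟨ *-distribˡ-sumFin t (λ m → L k m * x m) ⟨
      t * (L ·ᵥ x) k                    ∎

  0ᴹ : Matrix n
  0ᴹ _ _ = 0#

  0ᴹ-⊕ : M ≋ 0ᴹ ⊕ M
  0ᴹ-⊕ {M = M} i j = sym (+-identityˡ (M i j))

  0ᴹ-⊖ : ⊝ M ≋ 0ᴹ ⊖ M
  0ᴹ-⊖ {M = M} i j = sym (+-identityˡ (- M i j))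

  IsΘ-zero : IsΘ P Q 0ᴹ 0ᴹ
  IsΘ-zero {P = P} {Q = Q} i j k =
    trans (sumFin-zeroˡ (λ l → P l i * Q l j)) (sym (zeroˡ (P k i * Q k j)))

  IsΘ-cong : M ≋ N → IsΘ P Q M T → IsΘ P Q N T
  IsΘ-cong M≋N θ i j k = trans (sumFin-cong (λ l → *-congʳ (sym (M≋N k l)))) (θ i j k)

  IsΘ-scale : ∀ a → IsΘ P Q M T → IsΘ P Q (a ⊛ M) (a ⊛ T)
  IsΘ-scale {P = P} {Q = Q} {M = M} {T = T} a θ i j k = begin
    sumFin (λ l → (a * M k l) * v l) ≈⟨ sumFin-cong (λ l → *-assoc a (M k l) (v l)) ⟩
    sumFin (λ l → a * (M k l * v l)) ≈⟨ *-distribˡ-sumFin a (λ l → M k l * v l) ⟨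
    a * (M ·ᵥ v) k                   ≈⟨ *-congˡ (θ i j k) ⟩
    a * (T i j * v k)                ≈⟨ *-assoc a (T i j) (v k) ⟨
    (a * T i j) * v k                ∎
    where
    v : Vector K _
    v l = P l i * Q l j

  IsΘ-leftInverse : L · M ≋ I → NoZeroEntry T → IsΘ P Q M T → IsΘ P Q L (T ⁽⁻⁾)
  IsΘ-leftInverse LM≋I T≉0 θ i j = eigenpair-leftInverse LM≋I (T≉0 i j) (θ i j)

  braid⇒IsΘ : (∀ M → X A (Δ C (X A M)) ≋ Δ C (X A (Δ C M))) → IsΘ A C A C
  braid⇒IsΘ {A = A} {C = C} braid i j m = begin
    sumFin (λ l → A m l * (A l i * C l j))
      ≈⟨ sumFin-cong (λ l → *-congˡ (trans (*-comm (A l i) (C l j)) (*-congˡ (sym (Ae≈Aᵢ l))))) ⟩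
    X A (Δ C (X A E)) m j
      ≈⟨ braid E m j ⟩
    C m j * sumFin (λ l → A m l * (C l j * δ l i))
      ≈⟨ *-congˡ (trans (sumFin-cong (λ l → sym (*-assoc (A m l) (C l j) (δ l i))))
                        (sumFin-δʳ i (λ l → A m l * C l j))) ⟩
    C m j * (A m i * C i j)
      ≈⟨ x∙yz≈z∙yx (C m j) (A m i) (C i j) ⟩
    C i j * (A m i * C m j) ∎
    where
    E : Matrix _
    E p _ = δ p i
    Ae≈Aᵢ : ∀ l → (A · E) l j ≈ A l i
    Ae≈Aᵢ l = sumFin-δʳ i (A l)

  Δ-invertible⇒NoZeroEntry : InvertibleOp (Δ C) → NoZeroEntry C
  Δ-invertible⇒NoZeroEntry {C = C} (Δ⁻¹ , ΔΔ⁻¹≋id , _) i j Cij≈0 = 0≉1 (begin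
    0#                 ≈⟨ zeroˡ (Δ⁻¹ 𝟏 i j) ⟨
    0# * Δ⁻¹ 𝟏 i j     ≈⟨ *-congʳ Cij≈0 ⟨
    C i j * Δ⁻¹ 𝟏 i j  ≈⟨ ΔΔ⁻¹≋id 𝟏 i j ⟩
    1#                 ∎)
    where
    𝟏 : Matrix _
    𝟏 _ _ = 1#

  Vmat≋𝓜 : (d : K) (A B : Matrix n) →
    Vmat d A B ≋B 𝓜blocks 0ᴹ 0ᴹ (B ⁽⁻⁾) (B ⁽⁻⁾) (d ⊛ A) (d ⊛ A)
  Vmat≋𝓜 d A B 0F 0F = 0ᴹ-⊕
  Vmat≋𝓜 d A B 0F 1F = 0ᴹ-⊖
  Vmat≋𝓜 d A B 1F 0F = 0ᴹ-⊖
  Vmat≋𝓜 d A B 1F 1F = 0ᴹ-⊕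
  Vmat≋𝓜 d A B 2F 2F = 0ᴹ-⊕
  Vmat≋𝓜 d A B 2F 3F = 0ᴹ-⊖
  Vmat≋𝓜 d A B 3F 2F = 0ᴹ-⊖
  Vmat≋𝓜 d A B 3F 3F = 0ᴹ-⊕
  Vmat≋𝓜 d A B 0F 2F = λ _ _ → refl
  Vmat≋𝓜 d A B 0F 3F = λ _ _ → refl
  Vmat≋𝓜 d A B 1F 2F = λ _ _ → refl
  Vmat≋𝓜 d A B 1F 3F = λ _ _ → refl
  Vmat≋𝓜 d A B 2F 0F = λ _ _ → refl
  Vmat≋𝓜 d A B 2F 1F = λ _ _ → refl
  Vmat≋𝓜 d A B 3F 0F = λ _ _ → refl
  Vmat≋𝓜 d A B 3F 1F = λ _ _ → refl

theorem7p1 : ∀ {c ℓ} (𝔽 : ACF0 c ℓ) → let open Matrices 𝔽 in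
    (n : ℕ) (A B : Matrix n) (d : K) →
    InvertibleJonesPair A B → Symmetric A → (d * d) ≈ natR cring n →
    In𝓑 A B (Vmat d A B)
theorem7p1 𝔽 n A B d (((X⁻¹ , XX⁻¹≋id , _) , Δ-invertible , braid , braidᵀ) , _) symA _ = record
  { F = 0ᴹ ; G = R ; H = d ⊛ A ; Kp = d ⊛ A
  ; ΘAF = 0ᴹ ; ΘB⁻F = 0ᴹ ; ΘG = B ⁽⁻⁾ ; ΘGt = B ⁽⁻⁾ ; ΘH = d ⊛ B ; ΘKt = d ⊛ (B ᵀ)
  ; isΘAF = IsΘ-zero
  ; isΘB⁻F = IsΘ-zero
  ; isΘG = IsΘ-cong (leftInverse≋rightInverse RᵀA≋I AR≋I) isΘRᵀ
  ; isΘGt = isΘRᵀ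
  ; isΘH = IsΘ-scale d (braid⇒IsΘ braid)
  ; isΘKt = IsΘ-cong (λ i j → *-congˡ (sym (symA i j))) (IsΘ-scale d (braid⇒IsΘ braidᵀ))
  ; paired = λ _ _ → refl
  ; equal = Vmat≋𝓜 d A B
  }
  where
  open Matrices 𝔽
  open ACF0 𝔽 using (refl; sym; *-congˡ)
  open MatrixTheory 𝔽

  R : Matrix n
  R = X⁻¹ I

  AR≋I : A · R ≋ I
  AR≋I = XX⁻¹≋id I

  RᵀA≋I : R ᵀ · A ≋ I
  RᵀA≋I = rightInverse-of-symmetric symA AR≋I

  isΘRᵀ : IsΘ A B (R ᵀ) (B ⁽⁻⁾)
  isΘRᵀ = IsΘ-leftInverse RᵀA≋I (Δ-invertible⇒NoZeroEntry Δ-invertible) (braid⇒IsΘ braid)
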